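{- The sequence $(a_n)_{n\ge1}$ with $a_n=2^{4n-3}$ is realizable, i.e. there are a set $X$ and a map $T\colon X\to X$ such that $T^n$ has exactly $2^{4n-3}$ fixed points for every $n\ge1$.
   Context: A sequence $(a_n)_{n\ge1}$ of non-negative integers is realizable if there are a set $X$ and a map $T\colon X\to X$ such that $a_n$ is the number of fixed points of $T^n$ for every $n\ge1$. -}

module Defs where

open import Data.Nat using (ℕ; zero; suc)
open import Data.Fin using (Fin)
open import Data.Product using (Σ; ∃; _,_)
open import Function.Bundles using (_↔_)
open import Relation.Binary.PropositionalEquality using (_≡_)

iter : {X : Set} → (X → X) → ℕ → X → X
iter T zero    x = x
iter T (suc n) x = T (iter T n x)

Fix : {X : Set} → (X → X) → ℕ → Set
Fix {X} T n = Σ X (λ x → iter T n x ≡ x)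

HasFixCount : {X : Set} → (X → X) → ℕ → ℕ → Set
HasFixCount T n k = Fin k ↔ Fix T n

-- a sequence a : ℕ → ℕ (indexed from n = 1) is realizable
Realizable : (ℕ → ℕ) → Set₁
Realizable a = Σ Set (λ X → Σ (X → X) (λ T → (n : ℕ) → HasFixCount T (suc n) (a (suc n))))

{-# OPTIONS --safe #-}

-- The map is a skew product over the full shift on V = (ℤ/2)ᵏ.  The shift is modelled by
-- its periodic points: a point is a primitive word and T rotates it, so the fixed points of
-- Tⁿ correspond to the words of length n, each being a power of a unique primitive root.
-- The extra bit is flipped by c(w) = λₛ(w₀), where s is the letter sum of w and λₛ is a
-- linear functional with λₛ(s) = 1 whenever s ≠ 0.  Along a period n = q·|w| the flips add
-- up to λₛ(q·s), and q·s is the letter sum of the length-n word wᑫ; this vanishes exactly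
-- when q·s = 0.  Hence Tⁿ has 2 · #{u ∈ Vⁿ : Σu = 0} = 2 · 2^(k(n-1)) fixed points, which
-- is 2^(4n-3) for k = 4.

module Submission where

open import Defs
open import Axiom.UniquenessOfIdentityProofs.WithK using (uip)
open import Data.Bool using (Bool; true; false; _xor_)
import Data.Bool as Bool using (_≟_)
open import Data.Bool.Properties using (xor-assoc; xor-comm; xor-identityˡ; xor-identityʳ; xor-same)
open import Data.Fin using (Fin; zero; suc; toℕ; fromℕ; fromℕ<; inject; Fin′)
open import Data.Fin.Properties using (toℕ-fromℕ<; toℕ-fromℕ; toℕ-inject; fromℕ<-cong; fromℕ<-toℕ; toℕ<n; all?; ¬∀⟶∃¬-smallest; *↔×; 2↔Bool)
open import Data.Nat using (ℕ; zero; suc; _+_; _*_; _^_; _∸_; _≤_; _<_; s≤s; NonZero; _%_; _/_)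
open import Data.Nat.DivMod using (_mod_; m≡m%n+[m/n]*n; [m+n]%n≡m%n; m<n⇒m%n≡m; m%n<n)
open import Data.Nat.Divisibility using (_∣_; divides; m%n≡0⇒n∣m)
open import Data.Nat.Properties using (+-assoc; +-comm; +-suc; +-identityʳ; +-commutativeSemigroup; ≤-antisym; ≮⇒≥; suc-injective; ≡-irrelevant; *-suc; ^-*-assoc; <⇒≱)
open import Algebra.Properties.CommutativeSemigroup +-commutativeSemigroup using (xy∙z≈xz∙y)
open import Data.Product using (Σ; ∃; _×_; _,_; proj₁; proj₂; uncurry)
open import Data.Product.Function.Dependent.Propositional using (Σ-↔)
open import Data.Product.Function.NonDependent.Propositional using (_×-↔_)
open import Data.Sum using (_⊎_; inj₁; inj₂; map₂)
open import Data.Vec using (Vec; []; _∷_; lookup; tabulate; zipWith; replicate; foldr′)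
open import Data.Vec.Properties using (tabulate-cong; tabulate∘lookup; lookup∘tabulate; zipWith-assoc; zipWith-comm; zipWith-identityˡ; zipWith-identityʳ; ≡-dec)
open import Function using (_∘_; _↔_; mk↔ₛ′)
open import Function.Properties.Inverse using (↔-refl; ↔-trans; ↔-sym)
open import Relation.Binary.Definitions using (DecidableEquality)
open import Relation.Binary.PropositionalEquality using (_≡_; refl; sym; trans; cong; cong₂; subst; _≗_; module ≡-Reasoning)
open import Relation.Nullary using (¬_; ¬?; contradiction)
open import Relation.Nullary.Decidable using (map′; decidable-stable)
open import Relation.Unary using (Decidable)

open ≡-Reasoning

private variable
  A : Set
  k l m n p : ℕ
  f g : ℕ → A

module _ {X : Set} (T : X → X) (c : X → Bool) where

  skew : X × Bool → X × Bool
  skew (x , b) = T x , b xor c x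

  cocycle : ℕ → X → Bool
  cocycle zero    x = false
  cocycle (suc n) x = cocycle n x xor c (iter T n x)

  iter-skew : ∀ n x b → iter skew n (x , b) ≡ (iter T n x , b xor cocycle n x)
  iter-skew zero    x b = cong (x ,_) (sym (xor-identityʳ b))
  iter-skew (suc n) x b =
    trans (cong skew (iter-skew n x b)) (cong (T (iter T n x) ,_) (xor-assoc b _ _))

  Fix-skew↔ : ∀ n → Fix skew n ↔ (Bool × Σ (Fix T n) λ y → cocycle n (proj₁ y) ≡ false)
  Fix-skew↔ n = mk↔ₛ′ to from
    (λ _ → cong₂ (λ fx trivial → _ , (_ , fx) , trivial) (uip _ _) (uip _ _))
    (λ _ → cong (_ ,_) (uip _ _))
    where
    xor-≡ˡ : ∀ b {d} → b xor d ≡ b → d ≡ false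
    xor-≡ˡ false eq = eq
    xor-≡ˡ true {false} _ = refl
    xor-≡ˡ true {true} ()

    to : Fix skew n → Bool × Σ (Fix T n) λ y → cocycle n (proj₁ y) ≡ false
    to ((x , b) , fixed) = b , (x , cong proj₁ fixed′) , xor-≡ˡ b (cong proj₂ fixed′)
      where fixed′ = trans (sym (iter-skew n x b)) fixed

    from : Bool × Σ (Fix T n) (λ y → cocycle n (proj₁ y) ≡ false) → Fix skew n
    from (b , (x , fixed) , trivial) = (x , b) ,
      trans (iter-skew n x b) (cong₂ _,_ fixed (trans (cong (b xor_) trivial) (xor-identityʳ b)))

Periodic : (ℕ → A) → ℕ → Set
Periodic f p = ∀ i → f (i + p) ≡ f i

periodic-* : Periodic f p → ∀ q → Periodic f (q * p)
periodic-* {f = f} per zero i = cong f (+-identityʳ i)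
periodic-* {f = f} {p = p} per (suc q) i = begin
  f (i + (p + q * p))  ≡⟨ cong f (+-assoc i p (q * p)) ⟨
  f (i + p + q * p)    ≡⟨ periodic-* per q (i + p) ⟩
  f (i + p)            ≡⟨ per i ⟩
  f i                  ∎

periodic-%-index : .{{_ : NonZero p}} → Periodic f p → ∀ i → f (i % p) ≡ f i
periodic-%-index {p = p} {f = f} per i = begin
  f (i % p)              ≡⟨ periodic-* per (i / p) (i % p) ⟨
  f (i % p + i / p * p)  ≡⟨ cong f (m≡m%n+[m/n]*n i p) ⟨
  f i                    ∎

periodic-%-period : .{{_ : NonZero p}} → Periodic f p → Periodic f n → Periodic f (n % p)
periodic-%-period {p = p} {f = f} {n = n} perₚ perₙ i = begin
  f (i + n % p)                ≡⟨ periodic-* perₚ (n / p) (i + n % p) ⟨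
  f (i + n % p + n / p * p)    ≡⟨ cong f (+-assoc i (n % p) (n / p * p)) ⟩
  f (i + (n % p + n / p * p))  ≡⟨ cong (λ k → f (i + k)) (m≡m%n+[m/n]*n n p) ⟨
  f (i + n)                    ≡⟨ perₙ i ⟩
  f i                          ∎

periodic-shift : ∀ k → Periodic f p → Periodic (λ i → f (i + k)) p
periodic-shift {f = f} {p = p} k per i = trans (cong f (xy∙z≈xz∙y i p k)) (per (i + k))

periodic-unshift : Periodic f (suc l) → Periodic (f ∘ suc) p → Periodic f p
periodic-unshift {f = f} {l = l} {p = p} perₗ per i = begin
  f (i + p)              ≡⟨ perₗ (i + p) ⟨
  f (i + p + suc l)      ≡⟨ cong f (+-suc (i + p) l) ⟩
  f (suc (i + p + l))    ≡⟨ cong (f ∘ suc) (xy∙z≈xz∙y i p l) ⟩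
  f (suc (i + l + p))    ≡⟨ per (i + l) ⟩
  f (suc (i + l))        ≡⟨ cong f (+-suc i l) ⟨
  f (i + suc l)          ≡⟨ perₗ i ⟩
  f i                    ∎

periodic-≗ : f ≗ g → Periodic f p → Periodic g p
periodic-≗ f≗g per i = trans (sym (f≗g _)) (trans (per i) (f≗g i))

periodic-ext : .{{_ : NonZero p}} → Periodic f p → Periodic g p →
               (∀ (j : Fin p) → f (toℕ j) ≡ g (toℕ j)) → f ≗ g
periodic-ext {p = p} {f = f} {g = g} perf perg agree i = begin
  f i                ≡⟨ periodic-%-index perf i ⟨
  f (i % p)          ≡⟨ cong f (toℕ-fromℕ< (m%n<n i p)) ⟨
  f (toℕ (i mod p))  ≡⟨ agree (i mod p) ⟩
  g (toℕ (i mod p))  ≡⟨ cong g (toℕ-fromℕ< (m%n<n i p)) ⟩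
  g (i % p)          ≡⟨ periodic-%-index perg i ⟩
  g i                ∎

cycle : Vec A (suc l) → ℕ → A
cycle {l = l} w i = lookup w (i mod suc l)

prefix : (n : ℕ) → (ℕ → A) → Vec A n
prefix n f = tabulate (f ∘ toℕ)

prefix-cong : f ≗ g → prefix n f ≡ prefix n g
prefix-cong f≗g = tabulate-cong (f≗g ∘ toℕ)

cycle-periodic : (w : Vec A (suc l)) → Periodic (cycle w) (suc l)
cycle-periodic {l = l} w i = cong (lookup w) (fromℕ<-cong _ _ ([m+n]%n≡m%n i (suc l)) _ _)

cycle-lookup : (w : Vec A (suc l)) (j : Fin (suc l)) → cycle w (toℕ j) ≡ lookup w j
cycle-lookup w j =
  cong (lookup w) (trans (fromℕ<-cong _ _ (m<n⇒m%n≡m (toℕ<n j)) _ (toℕ<n j)) (fromℕ<-toℕ j _))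

prefix-cycle : (w : Vec A (suc l)) → prefix (suc l) (cycle w) ≡ w
prefix-cycle w = trans (tabulate-cong (cycle-lookup w)) (tabulate∘lookup w)

cycle-prefix : Periodic f (suc l) → cycle (prefix (suc l) f) ≗ f
cycle-prefix {f = f} {l = l} per = periodic-ext (cycle-periodic u) per
  (λ j → trans (cycle-lookup u j) (lookup∘tabulate (f ∘ toℕ) j))
  where u = prefix (suc l) f

cycle-injective : {w w′ : Vec A (suc l)} → cycle w ≗ cycle w′ → w ≡ w′
cycle-injective {w = w} {w′} e = trans (sym (prefix-cycle w)) (trans (prefix-cong e) (prefix-cycle w′))

rotateWord : Vec A (suc l) → Vec A (suc l)
rotateWord w = prefix _ (cycle w ∘ suc)

cycle-rotateWord : (w : Vec A (suc l)) → cycle (rotateWord w) ≗ cycle w ∘ suc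
cycle-rotateWord w = cycle-prefix (cycle-periodic w ∘ suc)

module Necklaces {A : Set} (_≟_ : DecidableEquality A) where

  periodic? : (w : Vec A (suc l)) → Decidable (Periodic (cycle w))
  periodic? w p = map′
    (periodic-ext (periodic-shift p (cycle-periodic w)) (cycle-periodic w))
    (λ per j → per (toℕ j))
    (all? λ j → cycle w (toℕ j + p) ≟ cycle w (toℕ j))

  -- Kept abstract: unfolding the search during unification is prohibitively expensive.
  private abstract
    leastPeriod : (w : Vec A (suc l)) → ∃ λ (i : Fin (suc l)) →
                  ¬ ¬ Periodic (cycle w) (suc (toℕ i)) ×
                  (∀ (j : Fin′ i) → ¬ Periodic (cycle w) (suc (toℕ (inject j))))
    leastPeriod {l = l} w =
      ¬∀⟶∃¬-smallest (suc l) _ (λ i → ¬? (periodic? w (suc (toℕ i))))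
        (λ none → none (fromℕ l) (subst (Periodic (cycle w) ∘ suc) (sym (toℕ-fromℕ l)) (cycle-periodic w)))

  minPeriod : Vec A (suc l) → ℕ
  minPeriod w = suc (toℕ (proj₁ (leastPeriod w)))

  minPeriod-periodic : (w : Vec A (suc l)) → Periodic (cycle w) (minPeriod w)
  minPeriod-periodic w = decidable-stable (periodic? w _) (proj₁ (proj₂ (leastPeriod w)))

  minPeriod-minimal : (w : Vec A (suc l)) → Periodic (cycle w) (suc p) → minPeriod w ≤ suc p
  minPeriod-minimal w per = s≤s (≮⇒≥ λ p<i →
    proj₂ (proj₂ (leastPeriod w)) (fromℕ< p<i)
      (subst (Periodic (cycle w) ∘ suc) (sym (trans (toℕ-inject _) (toℕ-fromℕ< p<i))) per))

  minPeriod-cong : (w : Vec A (suc l)) (w′ : Vec A (suc m)) →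
                   (∀ {p} → Periodic (cycle w) p → Periodic (cycle w′) p) →
                   (∀ {p} → Periodic (cycle w′) p → Periodic (cycle w) p) →
                   minPeriod w ≡ minPeriod w′
  minPeriod-cong w w′ to from = ≤-antisym
    (minPeriod-minimal w (from (minPeriod-periodic w′)))
    (minPeriod-minimal w′ (to (minPeriod-periodic w)))

  minPeriod-≗ : (w : Vec A (suc l)) (w′ : Vec A (suc m)) → cycle w ≗ cycle w′ →
                minPeriod w ≡ minPeriod w′
  minPeriod-≗ w w′ e = minPeriod-cong w w′ (periodic-≗ e) (periodic-≗ (sym ∘ e))

  Primitive : Vec A (suc l) → Set
  Primitive {l = l} w = minPeriod w ≡ suc l

  primitive-minimal : (w : Vec A (suc l)) → Primitive w → Periodic (cycle w) (suc p) → suc l ≤ suc p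
  primitive-minimal {p = p} w prim per = subst (_≤ suc p) prim (minPeriod-minimal w per)

  PrimitiveWord : Set
  PrimitiveWord = Σ ℕ λ l → Σ (Vec A (suc l)) Primitive

  length : PrimitiveWord → ℕ
  length (l , _) = suc l

  seq : PrimitiveWord → ℕ → A
  seq (_ , w , _) = cycle w

  seq-injective : ∀ {x y} → seq x ≗ seq y → x ≡ y
  seq-injective {l , w , prim} {l′ , w′ , prim′} e
    with refl ← suc-injective (≤-antisym
           (primitive-minimal w prim (periodic-≗ (sym ∘ e) (cycle-periodic w′)))
           (primitive-minimal w′ prim′ (periodic-≗ e (cycle-periodic w))))
    with refl ← cycle-injective {w = w} {w′} e
    = cong (λ prim → l , w , prim) (≡-irrelevant prim prim′)

  length∣period : ∀ x → Periodic (seq x) n → length x ∣ n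
  length∣period {n = n} (l , w , prim) per with n % suc l in r≡
  ... | zero  = m%n≡0⇒n∣m n (suc l) r≡
  ... | suc j = contradiction
    (primitive-minimal w prim (subst (Periodic (cycle w)) r≡ (periodic-%-period (cycle-periodic w) per)))
    (<⇒≱ (subst (_< suc l) r≡ (m%n<n n (suc l))))

  minPeriod-rotateWord : (w : Vec A (suc l)) → minPeriod (rotateWord w) ≡ minPeriod w
  minPeriod-rotateWord w = minPeriod-cong (rotateWord w) w
    (periodic-unshift (cycle-periodic w) ∘ periodic-≗ (cycle-rotateWord w))
    (periodic-≗ (sym ∘ cycle-rotateWord w) ∘ (_∘ suc))

  rotate : PrimitiveWord → PrimitiveWord
  rotate (l , w , prim) = l , rotateWord w , trans (minPeriod-rotateWord w) prim

  seq-iter-rotate : ∀ n x i → seq (iter rotate n x) i ≡ seq x (i + n)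
  seq-iter-rotate zero x i = cong (seq x) (sym (+-identityʳ i))
  seq-iter-rotate (suc n) x i = begin
    seq (rotate (iter rotate n x)) i  ≡⟨ cycle-rotateWord (proj₁ (proj₂ (iter rotate n x))) i ⟩
    seq (iter rotate n x) (suc i)     ≡⟨ seq-iter-rotate n x (suc i) ⟩
    seq x (suc i + n)                 ≡⟨ cong (seq x) (+-suc i n) ⟨
    seq x (i + suc n)                 ∎

  fixed⇒periodic : ∀ {x} → iter rotate n x ≡ x → Periodic (seq x) n
  fixed⇒periodic {n = n} {x} fixed i = trans (sym (seq-iter-rotate n x i)) (cong (λ y → seq y i) fixed)

  periodic⇒fixed : ∀ {x} → Periodic (seq x) n → iter rotate n x ≡ x
  periodic⇒fixed {n = n} {x} per = seq-injective (λ i → trans (seq-iter-rotate n x i) (per i))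

  root : Vec A (suc m) → PrimitiveWord
  root u = _ , prefix (minPeriod u) (cycle u) , minPeriod-≗ _ u (cycle-prefix (minPeriod-periodic u))

  seq-root : (u : Vec A (suc m)) → seq (root u) ≗ cycle u
  seq-root u = cycle-prefix (minPeriod-periodic u)

  Fix-rotate↔Vec : ∀ m → Fix rotate (suc m) ↔ Vec A (suc m)
  Fix-rotate↔Vec m = mk↔ₛ′ to from to∘from from∘to
    where
    to : Fix rotate (suc m) → Vec A (suc m)
    to (x , _) = prefix (suc m) (seq x)

    from : Vec A (suc m) → Fix rotate (suc m)
    from u = root u , periodic⇒fixed (periodic-≗ (sym ∘ seq-root u) (cycle-periodic u))

    to∘from : ∀ u → to (from u) ≡ u
    to∘from u = trans (prefix-cong (seq-root u)) (prefix-cycle u)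

    from∘to : ∀ y → from (to y) ≡ y
    from∘to (x , fixed) = Fix-≡ (seq-injective λ i →
      trans (seq-root (to (x , fixed)) i) (cycle-prefix (fixed⇒periodic fixed) i))
      where
      Fix-≡ : ∀ {x y} {fx : iter rotate (suc m) x ≡ x} {fy : iter rotate (suc m) y ≡ y} → x ≡ y →
              _≡_ {A = Fix rotate (suc m)} (x , fx) (y , fy)
      Fix-≡ refl = cong (_ ,_) (uip _ _)

Bits : ℕ → Set
Bits k = Vec Bool k

infixl 6 _⊕_

_⊕_ : Bits k → Bits k → Bits k
_⊕_ = zipWith _xor_

𝟎 : Bits k
𝟎 = replicate _ false

⊕-assoc : ∀ (x y z : Bits k) → (x ⊕ y) ⊕ z ≡ x ⊕ (y ⊕ z)
⊕-assoc = zipWith-assoc xor-assoc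

⊕-comm : ∀ (x y : Bits k) → x ⊕ y ≡ y ⊕ x
⊕-comm = zipWith-comm xor-comm

⊕-identityˡ : ∀ (x : Bits k) → 𝟎 ⊕ x ≡ x
⊕-identityˡ = zipWith-identityˡ xor-identityˡ

⊕-identityʳ : ∀ (x : Bits k) → x ⊕ 𝟎 ≡ x
⊕-identityʳ = zipWith-identityʳ xor-identityʳ

⊕-self : ∀ (x : Bits k) → x ⊕ x ≡ 𝟎
⊕-self []      = refl
⊕-self (b ∷ x) = cong₂ _∷_ (xor-same b) (⊕-self x)

⊕-cancelˡ : ∀ (x y z : Bits k) → x ⊕ y ≡ x ⊕ z → y ≡ z
⊕-cancelˡ x y z eq = begin
  y            ≡⟨ ⊕-identityˡ y ⟨
  𝟎 ⊕ y        ≡⟨ cong (_⊕ y) (⊕-self x) ⟨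
  x ⊕ x ⊕ y    ≡⟨ ⊕-assoc x x y ⟩
  x ⊕ (x ⊕ y)  ≡⟨ cong (x ⊕_) eq ⟩
  x ⊕ (x ⊕ z)  ≡⟨ ⊕-assoc x x z ⟨
  x ⊕ x ⊕ z    ≡⟨ cong (_⊕ z) (⊕-self x) ⟩
  𝟎 ⊕ z        ≡⟨ ⊕-identityˡ z ⟩
  z            ∎

⊕≡𝟎⇒≡ : ∀ (x y : Bits k) → x ⊕ y ≡ 𝟎 → x ≡ y
⊕≡𝟎⇒≡ x y eq = ⊕-cancelˡ y x y (trans (⊕-comm y x) (trans eq (sym (⊕-self y))))

sum : Vec (Bits k) n → Bits k
sum = foldr′ _⊕_ 𝟎

sum-prefix-suc : ∀ n (f : ℕ → Bits k) → sum (prefix (suc n) f) ≡ sum (prefix n f) ⊕ f n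
sum-prefix-suc zero    f = trans (⊕-identityʳ (f 0)) (sym (⊕-identityˡ (f 0)))
sum-prefix-suc (suc n) f =
  trans (cong (f 0 ⊕_) (sum-prefix-suc n (f ∘ suc))) (sym (⊕-assoc (f 0) _ (f (suc n))))

sum-prefix-+ : ∀ m n (f : ℕ → Bits k) →
               sum (prefix (m + n) f) ≡ sum (prefix m f) ⊕ sum (prefix n (λ i → f (m + i)))
sum-prefix-+ zero    n f = sym (⊕-identityˡ _)
sum-prefix-+ (suc m) n f =
  trans (cong (f 0 ⊕_) (sum-prefix-+ m n (f ∘ suc))) (sym (⊕-assoc (f 0) _ _))

sum-prefix-rotate : {f : ℕ → Bits k} → Periodic f n → sum (prefix n (f ∘ suc)) ≡ sum (prefix n f)
sum-prefix-rotate {n = n} {f} per = ⊕-cancelˡ (f 0) _ _ (begin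
  sum (prefix (suc n) f)  ≡⟨ sum-prefix-suc n f ⟩
  sum (prefix n f) ⊕ f n  ≡⟨ cong (sum (prefix n f) ⊕_) (per 0) ⟩
  sum (prefix n f) ⊕ f 0  ≡⟨ ⊕-comm _ (f 0) ⟩
  f 0 ⊕ sum (prefix n f)  ∎)

sum-prefix-+-period : {f : ℕ → Bits k} → Periodic f p →
                      sum (prefix (p + n) f) ≡ sum (prefix p f) ⊕ sum (prefix n f)
sum-prefix-+-period {p = p} {n = n} {f} per = trans (sum-prefix-+ p n f)
  (cong (sum (prefix p f) ⊕_) (cong sum (prefix-cong {n = n} λ i → trans (cong f (+-comm p i)) (per i))))

sum-prefix-multiple : {f : ℕ → Bits k} → Periodic f p → ∀ q →
                      sum (prefix (q * p) f) ≡ 𝟎 ⊎ sum (prefix (q * p) f) ≡ sum (prefix p f)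
sum-prefix-multiple per zero = inj₁ refl
sum-prefix-multiple {p = p} {f} per (suc q) with sum-prefix-multiple per q
... | inj₁ sum≡𝟎 = inj₂ (trans (sum-prefix-+-period per) (trans (cong (s ⊕_) sum≡𝟎) (⊕-identityʳ s)))
  where s = sum (prefix p f)
... | inj₂ sum≡s = inj₁ (trans (sum-prefix-+-period per) (trans (cong (s ⊕_) sum≡s) (⊕-self s)))
  where s = sum (prefix p f)

zero-sum↔ : Σ (Vec (Bits k) (suc m)) (λ u → sum u ≡ 𝟎) ↔ Vec (Bits k) m
zero-sum↔ = mk↔ₛ′ (λ { (_ ∷ v , _) → v }) (λ v → sum v ∷ v , ⊕-self (sum v)) (λ _ → refl)
  λ { (x ∷ v , x+v≡𝟎) → head-≡ (sym (⊕≡𝟎⇒≡ x (sum v) x+v≡𝟎)) }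
  where
  head-≡ : ∀ {x y : Bits k} {v} {p : sum (x ∷ v) ≡ 𝟎} {q : sum (y ∷ v) ≡ 𝟎} → x ≡ y →
           _≡_ {A = Σ (Vec (Bits k) (suc m)) (λ u → sum u ≡ 𝟎)} (x ∷ v , p) (y ∷ v , q)
  head-≡ {x = x} {v = v} refl = cong (x ∷ v ,_) (uip _ _)

-- The functional λₛ: pivot s t is the coordinate of t at the first nonzero position of s.
pivot : Bits k → Bits k → Bool
pivot []          []       = false
pivot (true  ∷ _) (b ∷ _)  = b
pivot (false ∷ s) (_ ∷ t)  = pivot s t

pivot-⊕ : ∀ (s t t′ : Bits k) → pivot s (t ⊕ t′) ≡ pivot s t xor pivot s t′
pivot-⊕ []          []      []       = refl
pivot-⊕ (true  ∷ s) (_ ∷ t) (_ ∷ t′) = refl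
pivot-⊕ (false ∷ s) (_ ∷ t) (_ ∷ t′) = pivot-⊕ s t t′

pivot-𝟎 : ∀ (s : Bits k) → pivot s 𝟎 ≡ false
pivot-𝟎 []          = refl
pivot-𝟎 (true  ∷ s) = refl
pivot-𝟎 (false ∷ s) = pivot-𝟎 s

pivot-self : ∀ (s : Bits k) → pivot s s ≡ false → s ≡ 𝟎
pivot-self []          _  = refl
pivot-self (false ∷ s) eq = cong (false ∷_) (pivot-self s eq)

module TwistedShift (k : ℕ) where
  open Necklaces {A = Bits k} (≡-dec Bool._≟_) public

  weight : PrimitiveWord → Bits k
  weight (_ , w , _) = sum w

  twist : PrimitiveWord → Bool
  twist x = pivot (weight x) (seq x 0)

  system : PrimitiveWord × Bool → PrimitiveWord × Bool
  system = skew rotate twist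

  weight-rotate : ∀ x → weight (rotate x) ≡ weight x
  weight-rotate (_ , w , _) = trans (sum-prefix-rotate (cycle-periodic w)) (cong sum (prefix-cycle w))

  weight-iter-rotate : ∀ n x → weight (iter rotate n x) ≡ weight x
  weight-iter-rotate zero    x = refl
  weight-iter-rotate (suc n) x = trans (weight-rotate (iter rotate n x)) (weight-iter-rotate n x)

  cocycle-twist : ∀ n x → cocycle rotate twist n x ≡ pivot (weight x) (sum (prefix n (seq x)))
  cocycle-twist zero    x = sym (pivot-𝟎 (weight x))
  cocycle-twist (suc n) x = begin
    cocycle rotate twist n x xor twist (iter rotate n x)
      ≡⟨ cong₂ _xor_ (cocycle-twist n x) (cong₂ pivot (weight-iter-rotate n x) (seq-iter-rotate n x 0)) ⟩
    pivot s (sum (prefix n (seq x))) xor pivot s (seq x n)  ≡⟨ pivot-⊕ s _ _ ⟨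
    pivot s (sum (prefix n (seq x)) ⊕ seq x n)              ≡⟨ cong (pivot s) (sum-prefix-suc n (seq x)) ⟨
    pivot s (sum (prefix (suc n) (seq x)))                  ∎
    where s = weight x

  sum-prefix-period : ∀ x → Periodic (seq x) n →
                      sum (prefix n (seq x)) ≡ 𝟎 ⊎ sum (prefix n (seq x)) ≡ weight x
  sum-prefix-period x@(_ , w , _) per with divides q refl ← length∣period x per =
    map₂ (λ e → trans e (cong sum (prefix-cycle w))) (sum-prefix-multiple (cycle-periodic w) q)

  cocycle≡false↔sum≡𝟎 : ∀ x → Periodic (seq x) n →
                        (cocycle rotate twist n x ≡ false) ↔ (sum (prefix n (seq x)) ≡ 𝟎)
  cocycle≡false↔sum≡𝟎 {n = n} x per = mk↔ₛ′ to from (λ _ → uip _ _) (λ _ → uip _ _)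
    where
    to : cocycle rotate twist n x ≡ false → sum (prefix n (seq x)) ≡ 𝟎
    to trivial with sum-prefix-period x per
    ... | inj₁ sum≡𝟎 = sum≡𝟎
    ... | inj₂ sum≡s = trans sum≡s (pivot-self (weight x)
            (subst (λ t → pivot (weight x) t ≡ false) sum≡s (trans (sym (cocycle-twist n x)) trivial)))

    from : sum (prefix n (seq x)) ≡ 𝟎 → cocycle rotate twist n x ≡ false
    from sum≡𝟎 = trans (cocycle-twist n x) (trans (cong (pivot (weight x)) sum≡𝟎) (pivot-𝟎 (weight x)))

  Fix-system↔ : ∀ m → Fix system (suc m) ↔ (Bool × Vec (Bits k) m)
  Fix-system↔ m = ↔-trans (Fix-skew↔ rotate twist (suc m)) (↔-refl ×-↔ ↔-trans
    (Σ-↔ (Fix-rotate↔Vec m) λ {y} → cocycle≡false↔sum≡𝟎 {n = suc m} (proj₁ y) (fixed⇒periodic (proj₂ y)))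
    zero-sum↔)

Vec↔Fin^ : {a : ℕ} → A ↔ Fin a → Vec A n ↔ Fin (a ^ n)
Vec↔Fin^ {n = zero}  _   = mk↔ₛ′ (λ _ → zero) (λ _ → []) (λ { zero → refl }) (λ { [] → refl })
Vec↔Fin^ {n = suc n} A↔a = ↔-trans
  (mk↔ₛ′ (λ { (x ∷ v) → x , v }) (uncurry _∷_) (λ _ → refl) (λ { (x ∷ v) → refl }))
  (↔-trans (A↔a ×-↔ Vec↔Fin^ A↔a) (↔-sym *↔×))

twistedShift-fixCount : ∀ k m → HasFixCount (TwistedShift.system k) (suc m) (2 * (2 ^ k) ^ m)
twistedShift-fixCount k m = ↔-sym (↔-trans (TwistedShift.Fix-system↔ k m)
  (↔-trans (↔-sym 2↔Bool ×-↔ Vec↔Fin^ (Vec↔Fin^ (↔-sym 2↔Bool))) (↔-sym *↔×)))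

mainTheorem7 : Realizable (λ n → 2 ^ (4 * n ∸ 3))
mainTheorem7 = _ , TwistedShift.system 4 , λ m →
  subst (HasFixCount (TwistedShift.system 4) (suc m)) (sym (exponent m)) (twistedShift-fixCount 4 m)
  where
  exponent : ∀ m → 2 ^ (4 * suc m ∸ 3) ≡ 2 * (2 ^ 4) ^ m
  exponent m = trans (cong (λ e → 2 ^ (e ∸ 3)) (*-suc 4 m)) (cong (2 *_) (sym (^-*-assoc 2 4 m)))
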